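{- Let $n\geq 2$ and let $C_n$ be the directed cycle on $n$ vertices. Then $\gamma^+_{maj}(C_n)=2$ if $n$ is even and $\gamma^+_{maj}(C_n)=3$ if $n$ is odd.
   Context: Digraphs are finite, without loops or multiple arcs (pairs of opposite arcs allowed). For a digraph $D=(V,A)$ and $u\in V$, $N^+[u]=\{u\}\cup\{v: uv\in A\}$. For $f:V\to\{ -1,1\}$ and $X\subseteq V$, $f(X)=\sum_{v\in X}f(v)$. A majority out-dominating function (MODF) of $D$ is a function $f:V\to\{ -1,1\}$ with $|\{v\in V: f(N^+[v])\geq1\}|\geq |V|/2$; its weight is $w(f)=f(V)$. $\gamma^+_{maj}(D)$ is the minimum weight of a MODF of $D$. -}

module Defs where

open import Data.Nat using (ℕ; zero; suc; _≤_; s≤s; z≤n; _*_; _+_)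
open import Data.Nat.DivMod using (_%_; m%n<n)
open import Data.Bool using (Bool; true; false; if_then_else_)
open import Data.Fin using (Fin; toℕ; fromℕ<)
open import Data.Integer as ℤ using (ℤ; +_; 0ℤ)
open import Data.Product using (Σ; _×_)
open import Relation.Nullary.Decidable using (⌊_⌋)
open import Relation.Binary.PropositionalEquality using (_≡_)

sumℕ : {n : ℕ} → (Fin n → ℕ) → ℕ
sumℕ {zero}  g = 0
sumℕ {suc n} g = g Data.Fin.zero + sumℕ (λ i → g (Data.Fin.suc i))

sumℤ : {n : ℕ} → (Fin n → ℤ) → ℤ
sumℤ {zero}  g = 0ℤ
sumℤ {suc n} g = g Data.Fin.zero ℤ.+ sumℤ (λ i → g (Data.Fin.suc i))

-- A finite digraph with vertex set Fin order, arc relation given by a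
-- Bool-valued adjacency function.  (Multiple arcs are impossible in this
-- encoding; opposite arcs are allowed.  Looplessness is not a field; the
-- only digraph used, the directed cycle C_n with n ≥ 2, is loopless.)
record Digraph : Set where
  field
    order    : ℕ
    arc      : Fin order → Fin order → Bool
open Digraph public

-- Functions V → {-1,1}, encoded by Bool (true ↦ 1, false ↦ -1).
SignFun : Digraph → Set
SignFun D = Fin (order D) → Bool

val : Bool → ℤ
val true  = + 1
val false = ℤ.- (+ 1)

fSum : (D : Digraph) → SignFun D → (Fin (order D) → Bool) → ℤ
fSum D f X = sumℤ (λ v → if X v then val (f v) else 0ℤ)

closedOutNbhd : (D : Digraph) → Fin (order D) → Fin (order D) → Bool
closedOutNbhd D u v = ⌊ u Data.Fin.≟ v ⌋ Data.Bool.∨ arc D u v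

goodVertex : (D : Digraph) → SignFun D → Fin (order D) → Bool
goodVertex D f v = ⌊ + 1 ℤ.≤? fSum D f (closedOutNbhd D v) ⌋

goodCount : (D : Digraph) → SignFun D → ℕ
goodCount D f = sumℕ (λ v → if goodVertex D f v then 1 else 0)

-- MODF: |{v : f(N⁺[v]) ≥ 1}| ≥ |V|/2, i.e. 2·count ≥ |V|.
IsMODF : (D : Digraph) → SignFun D → Set
IsMODF D f = order D ≤ 2 * goodCount D f

weight : (D : Digraph) → SignFun D → ℤ
weight D f = fSum D f (λ _ → true)

IsMajOutDomNumber : Digraph → ℤ → Set
IsMajOutDomNumber D w =
  Σ (SignFun D) (λ f → IsMODF D f × weight D f ≡ w)
  × (∀ (f : SignFun D) → IsMODF D f → w ℤ.≤ weight D f)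

succMod : (n : ℕ) → Fin (suc (suc n)) → Fin (suc (suc n))
succMod n i = fromℕ< (m%n<n (suc (toℕ i)) (suc (suc n)))

cycleArc : (n : ℕ) → Fin (suc (suc n)) → Fin (suc (suc n)) → Bool
cycleArc n u v = ⌊ succMod n u Data.Fin.≟ v ⌋


DirectedCycle : (n : ℕ) → 2 ≤ n → Digraph
DirectedCycle (suc (suc k)) (s≤s (s≤s z≤n)) =
  record { order = suc (suc k) ; arc = cycleArc k }

-- Every vertex v of C_n has the single out-neighbour v⁺, so v is good
-- (f(N⁺[v]) ≥ 1) exactly when f(v) = f(v⁺) = 1.  Let p, q be the numbers of
-- vertices with f = 1 and f = -1; then p + q = n and w(f) = p - q.
-- Lower bound: if q = 0 then w(f) = n.  Otherwise the MODF condition yields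
-- a vertex with f = 1, so walking round the cycle there is a sign change v
-- (f(v) = 1, f(v⁺) = -1); v is not good, so the number g of good vertices
-- is below p, and n ≤ 2g forces q + 2 ≤ p.  As p - q ≡ n (mod 2), this
-- sharpens to w(f) ≥ 2 + (n mod 2).
-- Upper bound: for n = (2 + r + s) + s with r = n mod 2, the function equal
-- to 1 exactly on the first 2 + r + s vertices has weight 2 + r and its
-- first 1 + r + s vertices are good.
module Submission where

open import Defs
open import Data.Nat using (ℕ; _≤_; _%_)
open import Data.Integer using (+_)
open import Data.Product using (_×_)
open import Relation.Binary.PropositionalEquality using (_≡_)

open import Data.Nat using (zero; suc; _+_; _*_; _<_; _∸_; _<ᵇ_; z≤n; s≤s)
import Data.Nat.Properties as ℕP
open import Data.Nat.DivMod using (_/_; m%n<n; m%n≤m; n%n≡0; m<n⇒m%n≡m; [m+n]%n≡m%n; %-distribˡ-+; m≡m%n+[m/n]*n; m*n%n≡0)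
open import Data.Nat.Tactic.RingSolver using (solve-∀)
open import Data.Bool using (Bool; true; false; if_then_else_; _∧_; _∨_; not)
open import Data.Bool.Properties using (T-≡; ∨-identityʳ; ∧-conicalˡ; not-injective)
open import Data.Fin as Fin using (Fin; zero; suc; toℕ; fromℕ<)
import Data.Fin.Properties as FinP
open import Data.Integer as ℤ using (ℤ; 0ℤ; _⊖_)
import Data.Integer.Properties as ℤP
open import Data.Product using (∃-syntax; _,_)
open import Data.Sum using (_⊎_; inj₁; inj₂)
open import Function using (Equivalence)
open import Relation.Nullary using (contradiction)
open import Relation.Nullary.Decidable using (⌊_⌋; ⌊⌋-map′)
open import Relation.Binary.PropositionalEquality using (_≢_; refl; sym; trans; cong; cong₂; subst; subst₂; module ≡-Reasoning)

count : {n : ℕ} → (Fin n → Bool) → ℕ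
count p = sumℕ (λ v → if p v then 1 else 0)

count-cong : {n : ℕ} {p q : Fin n → Bool} → (∀ v → p v ≡ q v) → count p ≡ count q
count-cong {zero}  eq = refl
count-cong {suc n} eq =
  cong₂ _+_ (cong (λ b → if b then 1 else 0) (eq zero)) (count-cong (λ v → eq (suc v)))

indicator-mono : {a b : Bool} → (a ≡ true → b ≡ true) →
  (if a then 1 else 0) ≤ (if b then 1 else 0)
indicator-mono {false} imp = z≤n
indicator-mono {true}  imp rewrite imp refl = ℕP.≤-refl

count-mono : {n : ℕ} {p q : Fin n → Bool} → (∀ v → p v ≡ true → q v ≡ true) →
  count p ≤ count q
count-mono {zero}  imp = z≤n
count-mono {suc n} imp =
  ℕP.+-mono-≤ (indicator-mono (imp zero)) (count-mono (λ v → imp (suc v)))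

count-< : {n : ℕ} {p q : Fin n → Bool} → (∀ v → p v ≡ true → q v ≡ true) →
  (w : Fin n) → p w ≡ false → q w ≡ true → count p < count q
count-< {suc n} imp zero pw qw rewrite pw | qw =
  s≤s (count-mono (λ v → imp (suc v)))
count-< {suc n} imp (suc w) pw qw =
  ℕP.+-mono-≤-< (indicator-mono (imp zero)) (count-< (λ v → imp (suc v)) w pw qw)

count-witness : {n : ℕ} (p : Fin n → Bool) → count p ≡ 0 ⊎ ∃[ v ] p v ≡ true
count-witness {zero}  p = inj₁ refl
count-witness {suc n} p with p zero in p0
... | true  = inj₂ (zero , p0)
... | false with count-witness (λ v → p (suc v))
...   | inj₁ none       = inj₁ none
...   | inj₂ (v , pv)   = inj₂ (suc v , pv)

count-complement : {n : ℕ} (p : Fin n → Bool) → count p + count (λ v → not (p v)) ≡ n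
count-complement {zero}  p = refl
count-complement {suc n} p with p zero
... | true  = cong suc (count-complement (λ v → p (suc v)))
... | false = trans (ℕP.+-suc _ _) (cong suc (count-complement (λ v → p (suc v))))

count-below : (n c : ℕ) → c ≤ n → count {n} (λ v → toℕ v <ᵇ c) ≡ c
count-below zero    zero    _         = refl
count-below (suc n) zero    _         = count-below n zero z≤n
count-below (suc n) (suc c) (s≤s c≤n) = cong suc (count-below n c c≤n)

sumℤ-zero : (n : ℕ) → sumℤ {n} (λ _ → 0ℤ) ≡ 0ℤ
sumℤ-zero zero    = refl
sumℤ-zero (suc n) = trans (ℤP.+-identityˡ _) (sumℤ-zero n)

sumℤ-cong : {n : ℕ} {g h : Fin n → ℤ} → (∀ u → g u ≡ h u) → sumℤ g ≡ sumℤ h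
sumℤ-cong {zero}  eq = refl
sumℤ-cong {suc n} eq = cong₂ ℤ._+_ (eq zero) (sumℤ-cong (λ u → eq (suc u)))

-- Equality tests commute with the successor (not definitional, since ⌊_⌋
-- is strict in the decision procedure).
≟-suc : {n : ℕ} (v u : Fin n) → ⌊ suc v Fin.≟ suc u ⌋ ≡ ⌊ v Fin.≟ u ⌋
≟-suc v u = ⌊⌋-map′ _ _ (v Fin.≟ u)

sumℤ-point : {n : ℕ} (g : Fin n → ℤ) (v : Fin n) →
  sumℤ (λ u → if ⌊ v Fin.≟ u ⌋ then g u else 0ℤ) ≡ g v
sumℤ-point {suc n} g zero    = trans (cong (ℤ._+_ (g zero)) (sumℤ-zero n)) (ℤP.+-identityʳ _)
sumℤ-point {suc n} g (suc v) = begin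
  0ℤ ℤ.+ sumℤ (λ u → if ⌊ suc v Fin.≟ suc u ⌋ then g (suc u) else 0ℤ)
    ≡⟨ ℤP.+-identityˡ _ ⟩
  sumℤ (λ u → if ⌊ suc v Fin.≟ suc u ⌋ then g (suc u) else 0ℤ)
    ≡⟨ sumℤ-cong (λ u → cong (λ b → if b then g (suc u) else 0ℤ) (≟-suc v u)) ⟩
  sumℤ (λ u → if ⌊ v Fin.≟ u ⌋ then g (suc u) else 0ℤ)
    ≡⟨ sumℤ-point (λ u → g (suc u)) v ⟩
  g (suc v) ∎
  where open ≡-Reasoning

sumℤ-pair : {n : ℕ} (g : Fin n → ℤ) (v w : Fin n) → v ≢ w →
  sumℤ (λ u → if ⌊ v Fin.≟ u ⌋ ∨ ⌊ w Fin.≟ u ⌋ then g u else 0ℤ) ≡ g v ℤ.+ g w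
sumℤ-pair {suc n} g zero    zero    v≢w = contradiction refl v≢w
sumℤ-pair {suc n} g zero    (suc w) v≢w = cong (ℤ._+_ (g zero)) (begin
  sumℤ (λ u → if ⌊ suc w Fin.≟ suc u ⌋ then g (suc u) else 0ℤ)
    ≡⟨ sumℤ-cong (λ u → cong (λ b → if b then g (suc u) else 0ℤ) (≟-suc w u)) ⟩
  sumℤ (λ u → if ⌊ w Fin.≟ u ⌋ then g (suc u) else 0ℤ)
    ≡⟨ sumℤ-point (λ u → g (suc u)) w ⟩
  g (suc w) ∎)
  where open ≡-Reasoning
sumℤ-pair {suc n} g (suc v) zero    v≢w = begin
  g zero ℤ.+ sumℤ (λ u → if ⌊ suc v Fin.≟ suc u ⌋ ∨ false then g (suc u) else 0ℤ)
    ≡⟨ cong (ℤ._+_ (g zero)) (sumℤ-cong (λ u → cong (λ b → if b then g (suc u) else 0ℤ)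
                                                     (trans (∨-identityʳ _) (≟-suc v u)))) ⟩
  g zero ℤ.+ sumℤ (λ u → if ⌊ v Fin.≟ u ⌋ then g (suc u) else 0ℤ)
    ≡⟨ cong (ℤ._+_ (g zero)) (sumℤ-point (λ u → g (suc u)) v) ⟩
  g zero ℤ.+ g (suc v)
    ≡⟨ ℤP.+-comm (g zero) (g (suc v)) ⟩
  g (suc v) ℤ.+ g zero ∎
  where open ≡-Reasoning
sumℤ-pair {suc n} g (suc v) (suc w) v≢w = begin
  0ℤ ℤ.+ sumℤ (λ u → if ⌊ suc v Fin.≟ suc u ⌋ ∨ ⌊ suc w Fin.≟ suc u ⌋ then g (suc u) else 0ℤ)
    ≡⟨ ℤP.+-identityˡ _ ⟩
  sumℤ (λ u → if ⌊ suc v Fin.≟ suc u ⌋ ∨ ⌊ suc w Fin.≟ suc u ⌋ then g (suc u) else 0ℤ)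
    ≡⟨ sumℤ-cong (λ u → cong (λ b → if b then g (suc u) else 0ℤ) (cong₂ _∨_ (≟-suc v u) (≟-suc w u))) ⟩
  sumℤ (λ u → if ⌊ v Fin.≟ u ⌋ ∨ ⌊ w Fin.≟ u ⌋ then g (suc u) else 0ℤ)
    ≡⟨ sumℤ-pair (λ u → g (suc u)) v w (λ v≡w → v≢w (cong suc v≡w)) ⟩
  g (suc v) ℤ.+ g (suc w) ∎
  where open ≡-Reasoning

sumℤ-signs : {n : ℕ} (f : Fin n → Bool) →
  sumℤ (λ v → val (f v)) ≡ count f ⊖ count (λ v → not (f v))
sumℤ-signs {zero}  f = refl
sumℤ-signs {suc n} f =
  trans (cong (ℤ._+_ (val (f zero))) (sumℤ-signs (λ v → f (suc v)))) (cons (f zero) _ _)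
  where
  cons : (b : Bool) (p q : ℕ) →
    val b ℤ.+ (p ⊖ q) ≡ (if b then 1 else 0) + p ⊖ ((if not b then 1 else 0) + q)
  cons true  p q = ℤP.distribʳ-⊖-+-pos 1 p q
  cons false p q = ℤP.distribʳ-⊖-+-neg 0 p q

nbhdSum-unique : (D : Digraph) (f : SignFun D) (v w : Fin (order D)) → v ≢ w →
  (∀ u → arc D v u ≡ ⌊ w Fin.≟ u ⌋) →
  fSum D f (closedOutNbhd D v) ≡ val (f v) ℤ.+ val (f w)
nbhdSum-unique D f v w v≢w out = trans
  (sumℤ-cong (λ u → cong (λ b → if ⌊ v Fin.≟ u ⌋ ∨ b then val (f u) else 0ℤ) (out u)))
  (sumℤ-pair (λ u → val (f u)) v w v≢w)

atLeastOne-pair : (a b : Bool) → ⌊ + 1 ℤ.≤? val a ℤ.+ val b ⌋ ≡ a ∧ b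
atLeastOne-pair true  true  = refl
atLeastOne-pair true  false = refl
atLeastOne-pair false true  = refl
atLeastOne-pair false false = refl

good-unique : (D : Digraph) (f : SignFun D) (v w : Fin (order D)) → v ≢ w →
  (∀ u → arc D v u ≡ ⌊ w Fin.≟ u ⌋) → goodVertex D f v ≡ f v ∧ f w
good-unique D f v w v≢w out =
  trans (cong (λ z → ⌊ + 1 ℤ.≤? z ⌋) (nbhdSum-unique D f v w v≢w out)) (atLeastOne-pair (f v) (f w))

-- If p + q ≤ 2g and g < p, then q + 2 ≤ p: the counting core of the lower
-- bound (p + q = n vertices, at most 2g of them allowed, g < p good ones).
gap-from-majority : (p q g : ℕ) → p + q ≤ 2 * g → g < p → 2 + q ≤ p
gap-from-majority p q g n≤2g g<p = ℕP.+-cancelˡ-≤ p (2 + q) p (begin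
  p + (2 + q)  ≡⟨ shuffle p q ⟩
  2 + (p + q)  ≤⟨ ℕP.+-monoʳ-≤ 2 n≤2g ⟩
  2 + 2 * g    ≡⟨ cong suc (sym (ℕP.+-suc g (g + 0))) ⟩
  2 * suc g    ≤⟨ ℕP.*-monoʳ-≤ 2 g<p ⟩
  2 * p        ≡⟨ cong (_+_ p) (ℕP.+-identityʳ p) ⟩
  p + p        ∎)
  where
  open ℕP.≤-Reasoning
  shuffle : (p q : ℕ) → p + (2 + q) ≡ 2 + (p + q)
  shuffle = solve-∀

-- p - q and p + q have the same parity, so a gap q + 2 ≤ p can be raised
-- to q + 2 + ((p + q) mod 2) ≤ p.
gap-parity : (p q : ℕ) → 2 + q ≤ p → 2 + (p + q) % 2 + q ≤ p
gap-parity p q gap with ℕP.m≤n⇒m<n∨m≡n gap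
... | inj₁ 3+q≤p = ℕP.≤-trans (ℕP.+-monoˡ-≤ q (ℕP.+-monoʳ-≤ 2 r≤1)) 3+q≤p
  where
  r≤1 : (p + q) % 2 ≤ 1
  r≤1 = ℕP.≤-pred (m%n<n (p + q) 2)
... | inj₂ refl = ℕP.≤-reflexive (cong (λ r → 2 + r + q) (trans (cong (_% 2) (double q)) (m*n%n≡0 (suc q) 2)))
  where
  double : (q : ℕ) → 2 + q + q ≡ suc q * 2
  double = solve-∀

⊖-lower : (c p q : ℕ) → c + q ≤ p → + c ℤ.≤ p ⊖ q
⊖-lower c p q c+q≤p rewrite ℤP.⊖-≥ (ℕP.≤-trans (ℕP.m≤n+m q c) c+q≤p) =
  ℤ.+≤+ (ℕP.m+n≤o⇒m≤o∸n c c+q≤p)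

signChange : (h : ℕ → Bool) (a d : ℕ) → h a ≡ true → h (d + a) ≡ false →
  ∃[ j ] (h j ≡ true × h (suc j) ≡ false)
signChange h a zero    ha hd = contradiction (trans (sym ha) hd) (λ ())
signChange h a (suc d) ha hd with h (d + a) in hj
... | true  = d + a , hj , hd
... | false = signChange h a d ha hj

module Cycle (k : ℕ) where

  n : ℕ
  n = suc (suc k)

  C : Digraph
  C = DirectedCycle n (s≤s (s≤s z≤n))

  next : Fin n → Fin n
  next = succMod k

  -- Vertex i mod n; so next v is definitionally rot (1 + toℕ v).
  rot : ℕ → Fin n
  rot i = fromℕ< (m%n<n i n)

  rot-cong : {i j : ℕ} → i % n ≡ j % n → rot i ≡ rot j
  rot-cong {i} {j} eq = FinP.fromℕ<-cong (i % n) (j % n) eq (m%n<n i n) (m%n<n j n)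

  rot-toℕ : (v : Fin n) → rot (toℕ v) ≡ v
  rot-toℕ v = trans (FinP.fromℕ<-cong _ _ (m<n⇒m%n≡m (FinP.toℕ<n v)) _ (FinP.toℕ<n v))
                    (FinP.fromℕ<-toℕ v (FinP.toℕ<n v))

  next-rot : (i : ℕ) → next (rot i) ≡ rot (suc i)
  next-rot i = rot-cong {suc (toℕ (rot i))} {suc i} (begin
    suc (toℕ (rot i)) % n       ≡⟨ cong (λ x → suc x % n) (FinP.toℕ-fromℕ< (m%n<n i n)) ⟩
    (1 + i % n) % n             ≡⟨ %-distribˡ-+ 1 i n ⟨
    suc i % n                   ∎)
    where open ≡-Reasoning

  toℕ-next : (v : Fin n) → toℕ (next v) ≡ suc (toℕ v) % n
  toℕ-next v = FinP.toℕ-fromℕ< (m%n<n (suc (toℕ v)) n)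

  -- C_n has no loops (this is where n ≥ 2 is used).
  next-≢ : (v : Fin n) → v ≢ next v
  next-≢ v v≡next with ℕP.m≤n⇒m<n∨m≡n (FinP.toℕ<n v)
  ... | inj₁ 1+v<n = ℕP.1+n≢n (sym (trans (cong toℕ v≡next) (trans (toℕ-next v) (m<n⇒m%n≡m 1+v<n))))
  ... | inj₂ 1+v≡n = contradiction (trans (sym (cong suc v≡0)) 1+v≡n) (λ ())
    where
    v≡0 : toℕ v ≡ 0
    v≡0 = trans (cong toℕ v≡next) (trans (toℕ-next v) (trans (cong (_% n) 1+v≡n) (n%n≡0 n)))

  goodCount-cycle : (f : SignFun C) → goodCount C f ≡ count (λ v → f v ∧ f (next v))
  goodCount-cycle f = count-cong (λ v → good-unique C f v (next v) (next-≢ v) (λ _ → refl))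

  -- A sign function taking both values has a sign change v: f v = 1, f v⁺ = -1.
  -- Walk along the cycle from t to (a copy of) w.
  cycle-signChange : (f : Fin n → Bool) (t w : Fin n) → f t ≡ true → f w ≡ false →
    ∃[ v ] (f v ≡ true × f (next v) ≡ false)
  cycle-signChange f t w ft fw
    with signChange (λ i → f (rot i)) (toℕ t) (toℕ w + n ∸ toℕ t)
                    (trans (cong f (rot-toℕ t)) ft) (trans (cong f wrap) fw)
    where
    t≤w+n : toℕ t ≤ toℕ w + n
    t≤w+n = ℕP.≤-trans (ℕP.<⇒≤ (FinP.toℕ<n t)) (ℕP.m≤n+m n (toℕ w))
    wrap : rot (toℕ w + n ∸ toℕ t + toℕ t) ≡ w
    wrap = trans (cong rot (ℕP.m∸n+n≡m t≤w+n))
                 (trans (rot-cong {toℕ w + n} {toℕ w} ([m+n]%n≡m%n (toℕ w) n)) (rot-toℕ w))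
  ... | j , fj , fj⁺ = rot j , fj , trans (cong f (next-rot j)) fj⁺

  modf-gap : (f : SignFun C) → IsMODF C f → 2 + count (λ v → not (f v)) ≤ count f
  modf-gap f modf with count-witness (λ v → not (f v))
  ... | inj₁ noMinus = subst (_≤ count f) (cong (_+_ 2) (sym noMinus))
                         (subst (2 ≤_) allPlus (s≤s (s≤s z≤n)))
    where
    allPlus : n ≡ count f
    allPlus = trans (sym (count-complement f))
                    (trans (cong (_+_ (count f)) noMinus) (ℕP.+-identityʳ (count f)))
  ... | inj₂ (w , fw⁻) with count-witness (λ v → f v ∧ f (next v))
  ...   | inj₁ noGood = contradiction (subst (λ g → n ≤ 2 * g) (trans (goodCount-cycle f) noGood) modf) (λ ())
  ...   | inj₂ (t , tGood) with cycle-signChange f t w (∧-conicalˡ (f t) _ tGood) (not-injective fw⁻)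
  ...     | v , fv , fv⁺ =
    gap-from-majority (count f) (count (λ u → not (f u))) (count (λ u → f u ∧ f (next u)))
      (subst₂ _≤_ (sym (count-complement f)) (cong (_*_ 2) (goodCount-cycle f)) modf)
      (count-< (λ u → ∧-conicalˡ (f u) (f (next u))) v (cong₂ _∧_ fv fv⁺) fv)

  weight-lower : (f : SignFun C) → IsMODF C f → + (2 + n % 2) ℤ.≤ weight C f
  weight-lower f modf = subst (+ (2 + n % 2) ℤ.≤_) (sym (sumℤ-signs f))
    (⊖-lower (2 + n % 2) (count f) (count (λ v → not (f v)))
      (subst (λ m → 2 + m % 2 + count (λ v → not (f v)) ≤ count f) (count-complement f)
        (gap-parity (count f) (count (λ v → not (f v))) (modf-gap f modf))))

  prefix : ℕ → SignFun C
  prefix c v = toℕ v <ᵇ c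

  -- For the prefix of length c + 1 every vertex v < c is good, because
  -- v⁺ ≤ v + 1 ≤ c; so at least c vertices are good.
  prefix-good : (c : ℕ) → c ≤ n → c ≤ goodCount C (prefix (suc c))
  prefix-good c c≤n = begin
    c                                                          ≡⟨ count-below n c c≤n ⟨
    count {n} (λ v → toℕ v <ᵇ c)                               ≤⟨ count-mono below ⟩
    count (λ v → prefix (suc c) v ∧ prefix (suc c) (next v))   ≡⟨ goodCount-cycle (prefix (suc c)) ⟨
    goodCount C (prefix (suc c))                               ∎
    where
    open ℕP.≤-Reasoning
    <ᵇ-sound : (a b : ℕ) → (a <ᵇ b) ≡ true → a < b
    <ᵇ-sound a b eq = ℕP.<ᵇ⇒< a b (Equivalence.from T-≡ eq)
    <ᵇ-complete : (a b : ℕ) → a < b → (a <ᵇ b) ≡ true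
    <ᵇ-complete a b a<b = Equivalence.to T-≡ (ℕP.<⇒<ᵇ a<b)
    below : (v : Fin n) → (toℕ v <ᵇ c) ≡ true → (prefix (suc c) v ∧ prefix (suc c) (next v)) ≡ true
    below v v<c = cong₂ _∧_ (<ᵇ-complete (toℕ v) (suc c) (ℕP.m≤n⇒m≤1+n v<c′))
      (<ᵇ-complete (toℕ (next v)) (suc c)
        (s≤s (ℕP.≤-trans (ℕP.≤-reflexive (toℕ-next v)) (ℕP.≤-trans (m%n≤m (suc (toℕ v)) n) v<c′))))
      where
      v<c′ : toℕ v < c
      v<c′ = <ᵇ-sound (toℕ v) c v<c

  -- Upper bound: if n = (e + s) + s with e = 2 + d ≥ 2, the prefix of length
  -- e + s is a MODF of weight e.
  prefix-witness : (d s : ℕ) → n ≡ 2 + d + s + s →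
    ∃[ f ] (IsMODF C f × weight C f ≡ + (2 + d))
  prefix-witness d s n≡ = prefix c , modf , wt
    where
    e : ℕ
    e = 2 + d
    c : ℕ
    c = e + s
    c≤n : c ≤ n
    c≤n = subst (c ≤_) (sym n≡) (ℕP.m≤m+n c s)
    plus : count (prefix c) ≡ c
    plus = count-below n c c≤n
    minus : count (λ v → not (prefix c v)) ≡ s
    minus = ℕP.+-cancelˡ-≡ c _ s
      (trans (cong (_+ count (λ v → not (prefix c v))) (sym plus)) (trans (count-complement (prefix c)) n≡))
    wt : weight C (prefix c) ≡ + e
    wt = trans (sumℤ-signs (prefix c))
      (trans (cong₂ _⊖_ plus minus) (trans (ℤP.⊖-≥ (ℕP.m≤n+m s e)) (cong +_ (ℕP.m+n∸n≡m e s))))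
    -- n = 2 + d + 2s ≤ 2 (1 + d + s), and the first 1 + d + s vertices are good.
    twice : (d s : ℕ) → 2 * (suc d + s) ≡ (2 + d + s + s) + d
    twice = solve-∀
    modf : n ≤ 2 * goodCount C (prefix c)
    modf = begin
      n                          ≡⟨ n≡ ⟩
      e + s + s                  ≤⟨ ℕP.m≤m+n (e + s + s) d ⟩
      e + s + s + d              ≡⟨ twice d s ⟨
      2 * (suc d + s)            ≤⟨ ℕP.*-monoʳ-≤ 2 (prefix-good (suc d + s) (ℕP.≤-trans (ℕP.n≤1+n _) c≤n)) ⟩
      2 * goodCount C (prefix c) ∎
      where open ℕP.≤-Reasoning

  -- n = 2 + k with k = (k mod 2) + 2 (k div 2); note n mod 2 reduces to
  -- k mod 2.
  n-split : n ≡ 2 + n % 2 + k / 2 + k / 2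
  n-split = trans (cong (_+_ 2) (m≡m%n+[m/n]*n k 2)) (rearrange (k % 2) (k / 2))
    where
    rearrange : (r s : ℕ) → 2 + (r + s * 2) ≡ 2 + r + s + s
    rearrange = solve-∀

  cycle-majOutDom : IsMajOutDomNumber C (+ (2 + n % 2))
  cycle-majOutDom = prefix-witness (n % 2) (k / 2) n-split , weight-lower

proposition3p1 : ∀ (n : ℕ) (h : 2 ≤ n) →
    ((n % 2 ≡ 0 → IsMajOutDomNumber (DirectedCycle n h) (+ 2))
    × (n % 2 ≡ 1 → IsMajOutDomNumber (DirectedCycle n h) (+ 3)))
proposition3p1 (suc (suc k)) (s≤s (s≤s z≤n)) = parity 0 , parity 1
  where
  open Cycle k using (C; cycle-majOutDom)
  parity : (r : ℕ) → suc (suc k) % 2 ≡ r → IsMajOutDomNumber C (+ (2 + r))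
  parity r eq = subst (λ r′ → IsMajOutDomNumber C (+ (2 + r′))) eq cycle-majOutDom
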